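{- Let $n\ge 5$ and let $\sigma$ be a maximal simplex of $\Delta_n=\mathcal{VR}(\mathbb{I}_n;3)$. If $|N(w)\cap\sigma|\ge 2$ for all $w\in\sigma$, then there exists $\tilde v\in\sigma$ with $|N(\tilde v)\cap\sigma|\ge 3$.
   Context: $\mathbb{I}_n$ is the graph on $\{0,1\}^n$, two strings adjacent iff they differ in exactly one coordinate; distance is the number of differing coordinates. $\Delta_n=\mathcal{VR}(\mathbb{I}_n;3)$ is the simplicial complex whose simplices are the sets of vertices with pairwise distance at most $3$. $N(v)$ denotes the set of neighbours of $v$ in $\mathbb{I}_n$. -}

module Defs where

open import Data.Nat using (ℕ; zero; suc; _≤_; _+_)
open import Data.Bool using (Bool; true; false; if_then_else_)
open import Data.Vec using (Vec; []; _∷_)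
open import Data.List using (List; []; _∷_; length; filter)
open import Data.List.Membership.Propositional using (_∈_)
open import Data.List.Relation.Unary.Unique.Propositional using (Unique)
open import Data.List.Relation.Binary.Subset.Propositional using (_⊆_)
open import Data.Product using (_×_)
open import Data.Bool.Properties using () renaming (_≟_ to _≟ᵇ_)
open import Relation.Nullary using (¬_; does)
open import Relation.Binary.PropositionalEquality using (_≡_)
import Data.Nat.Properties as ℕP

Vertex : ℕ → Set
Vertex n = Vec Bool n

-- Hamming distance = shortest-path distance in I_n.
dist : ∀ {n} → Vertex n → Vertex n → ℕ
dist [] [] = 0
dist (a ∷ x) (b ∷ y) = (if does (a ≟ᵇ b) then 0 else 1) + dist x y

Adj : ∀ {n} → Vertex n → Vertex n → Set
Adj u v = dist u v ≡ 1

IsSimplex : ∀ {n} → List (Vertex n) → Set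
IsSimplex {n} σ =
  Unique σ × ¬ (σ ≡ []) × (∀ {u v} → u ∈ σ → v ∈ σ → dist u v ≤ 3)

IsMaximalSimplex : ∀ {n} → List (Vertex n) → Set
IsMaximalSimplex {n} σ =
  IsSimplex σ × (∀ (τ : List (Vertex n)) → IsSimplex τ → σ ⊆ τ → τ ⊆ σ)

-- |N(w) ∩ σ|: number of elements of σ adjacent to w (σ duplicate-free).
nbrCount : ∀ {n} → Vertex n → List (Vertex n) → ℕ
nbrCount w σ = length (filter (λ v → dist w v ℕP.≟ 1) σ)

-- Suppose every vertex of σ had exactly two σ-neighbours. Take v ∈ σ with σ-neighbours a, b and
-- let c = v ⊕ a ⊕ b be the fourth corner of their square, so that
-- dist v u + dist c u = dist a u + dist b u for every u. Since I_n is bipartite, every w ∈ σ at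
-- odd distance from v (that is, a, b, or a vertex at distance 3) lies within 1 of c. Each u ∈ σ
-- at distance 2 from v has such a σ-neighbour, so c is within 3 of all of σ and lies in σ by
-- maximality. Then no u ∈ σ is at distance 3 from v, since it would be a σ-neighbour of c other
-- than a and b; so every hypercube neighbour of v is within 3 of σ, hence in σ, and v has at
-- least three σ-neighbours.
module Submission where

open import Defs
open import Data.Nat using (ℕ; _≤_)
open import Data.List using (List)
open import Data.List.Membership.Propositional using (_∈_)
open import Data.Product using (Σ; _×_)

import Data.Nat.Properties as ℕP
open import Algebra.Properties.CommutativeSemigroup ℕP.+-commutativeSemigroup using (interchange)
open import Data.Bool using (Bool; true; false; not; _xor_; if_then_else_)
open import Data.Bool.Properties using (not-¬) renaming (_≟_ to _≟ᵇ_)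
open import Data.Empty using (⊥; ⊥-elim)
open import Data.List using ([]; _∷_; length)
open import Data.List.Membership.Propositional using (find; lose)
open import Data.List.Membership.Propositional.Properties using (∈-filter⁺; ∈-filter⁻)
import Data.List.Membership.DecPropositional as DecMembership
open import Data.List.Relation.Unary.All using (_∷_; tabulate)
open import Data.List.Relation.Unary.AllPairs using (_∷_)
open import Data.List.Relation.Unary.Any using (here; there; any?)
open import Data.List.Relation.Unary.Unique.Propositional using (Unique)
import Data.List.Relation.Unary.Unique.Propositional.Properties as Unique
open import Data.Nat using (zero; suc; _+_; _*_; _<_; _%_; z≤n; s≤s)
open import Data.Nat.DivMod using ([m+kn]%n≡m%n)
open import Data.Product using (_,_; proj₁; proj₂; ∃-syntax)
open import Data.Sum using (_⊎_; inj₁; inj₂)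
open import Data.Vec using ([]; _∷_; zipWith)
open import Data.Vec.Properties using (∷-injectiveˡ; ∷-injectiveʳ; ≡-dec)
open import Function using (_∘_)
open import Relation.Nullary using (¬_; Dec; does; yes; no; contradiction)
open import Relation.Binary.PropositionalEquality
  using (_≡_; _≢_; refl; sym; trans; cong; cong₂; subst; module ≡-Reasoning)

private
  variable
    n : ℕ

-- the summand of Defs.dist, so dist (p ∷ x) (q ∷ y) reduces to bitDist p q + dist x y
bitDist : Bool → Bool → ℕ
bitDist p q = if does (p ≟ᵇ q) then 0 else 1

dist-self : (x : Vertex n) → dist x x ≡ 0
dist-self []          = refl
dist-self (true  ∷ x) = dist-self x
dist-self (false ∷ x) = dist-self x

dist-sym : (x y : Vertex n) → dist x y ≡ dist y x
dist-sym []          []          = refl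
dist-sym (true  ∷ x) (true  ∷ y) = dist-sym x y
dist-sym (true  ∷ x) (false ∷ y) = cong suc (dist-sym x y)
dist-sym (false ∷ x) (true  ∷ y) = cong suc (dist-sym x y)
dist-sym (false ∷ x) (false ∷ y) = dist-sym x y

dist≡0⇒≡ : {x y : Vertex n} → dist x y ≡ 0 → x ≡ y
dist≡0⇒≡ {x = []}          {[]}          _ = refl
dist≡0⇒≡ {x = true  ∷ x}   {true  ∷ y}   e = cong (true ∷_) (dist≡0⇒≡ e)
dist≡0⇒≡ {x = false ∷ x}   {false ∷ y}   e = cong (false ∷_) (dist≡0⇒≡ e)
dist≡0⇒≡ {x = true  ∷ _}   {false ∷ _}   ()
dist≡0⇒≡ {x = false ∷ _}   {true  ∷ _}   ()

bitDist-triangle : ∀ p q r → bitDist p r ≤ bitDist p q + bitDist q r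
bitDist-triangle true  _     true  = z≤n
bitDist-triangle false _     false = z≤n
bitDist-triangle true  true  false = s≤s z≤n
bitDist-triangle true  false false = s≤s z≤n
bitDist-triangle false true  true  = s≤s z≤n
bitDist-triangle false false true  = s≤s z≤n

dist-triangle : (x y z : Vertex n) → dist x z ≤ dist x y + dist y z
dist-triangle []      []      []      = z≤n
dist-triangle (p ∷ x) (q ∷ y) (r ∷ z) = begin
  bitDist p r + dist x z                              ≤⟨ ℕP.+-mono-≤ (bitDist-triangle p q r) (dist-triangle x y z) ⟩
  (bitDist p q + bitDist q r) + (dist x y + dist y z) ≡⟨ interchange (bitDist p q) _ _ _ ⟩
  (bitDist p q + dist x y) + (bitDist q r + dist y z) ∎
  where open ℕP.≤-Reasoning

dist-∷-same : ∀ p (x y : Vertex n) → dist (p ∷ x) (p ∷ y) ≡ dist x y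
dist-∷-same true  _ _ = refl
dist-∷-same false _ _ = refl

dist-∷-not : ∀ p (x : Vertex n) → dist (p ∷ x) (not p ∷ x) ≡ 1
dist-∷-not true  x = cong suc (dist-self x)
dist-∷-not false x = cong suc (dist-self x)

three-neighbours : 3 ≤ n → (v : Vertex n) →
  ∃[ x ] ∃[ y ] ∃[ z ] Adj v x × Adj v y × Adj v z × x ≢ y × x ≢ z × y ≢ z
three-neighbours (s≤s (s≤s (s≤s _))) (p ∷ q ∷ r ∷ t) =
  not p ∷ q ∷ r ∷ t , p ∷ not q ∷ r ∷ t , p ∷ q ∷ not r ∷ t ,
  dist-∷-not p (q ∷ r ∷ t) ,
  trans (dist-∷-same p (q ∷ r ∷ t) _) (dist-∷-not q (r ∷ t)) ,
  trans (dist-∷-same p (q ∷ r ∷ t) _) (trans (dist-∷-same q (r ∷ t) _) (dist-∷-not r t)) ,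
  not-¬ refl ∘ sym ∘ ∷-injectiveˡ ,
  not-¬ refl ∘ sym ∘ ∷-injectiveˡ ,
  not-¬ refl ∘ sym ∘ ∷-injectiveˡ ∘ ∷-injectiveʳ

bitApart : Bool → Bool → Bool → ℕ
bitApart z x y = if does (x ≟ᵇ y) then bitDist z x else 0

apartFromBoth : Vertex n → Vertex n → Vertex n → ℕ
apartFromBoth []       []       []       = 0
apartFromBoth (z ∷ zs) (x ∷ xs) (y ∷ ys) = bitApart z x y + apartFromBoth zs xs ys

bitDist-detour : ∀ z x y → bitDist z x + bitDist z y ≡ bitDist x y + bitApart z x y * 2
bitDist-detour true  true  true  = refl
bitDist-detour true  true  false = refl
bitDist-detour true  false true  = refl
bitDist-detour true  false false = refl
bitDist-detour false true  true  = refl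
bitDist-detour false true  false = refl
bitDist-detour false false true  = refl
bitDist-detour false false false = refl

dist-detour : (z x y : Vertex n) → dist z x + dist z y ≡ dist x y + apartFromBoth z x y * 2
dist-detour []      []      []      = refl
dist-detour (r ∷ z) (p ∷ x) (q ∷ y) = begin
  (bitDist r p + dist z x) + (bitDist r q + dist z y)
    ≡⟨ interchange (bitDist r p) _ _ _ ⟩
  (bitDist r p + bitDist r q) + (dist z x + dist z y)
    ≡⟨ cong₂ _+_ (bitDist-detour r p q) (dist-detour z x y) ⟩
  (bitDist p q + bitApart r p q * 2) + (dist x y + apartFromBoth z x y * 2)
    ≡⟨ interchange (bitDist p q) _ _ _ ⟩
  (bitDist p q + dist x y) + (bitApart r p q * 2 + apartFromBoth z x y * 2)
    ≡⟨ cong (bitDist p q + dist x y +_) (sym (ℕP.*-distribʳ-+ 2 (bitApart r p q) _)) ⟩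
  (bitDist p q + dist x y) + (bitApart r p q + apartFromBoth z x y) * 2
    ∎
  where open ≡-Reasoning

dist-parity : (z x y : Vertex n) → (dist z x + dist z y) % 2 ≡ dist x y % 2
dist-parity z x y =
  trans (cong (_% 2) (dist-detour z x y)) ([m+kn]%n≡m%n (dist x y) (apartFromBoth z x y) 2)

opposite : Vertex n → Vertex n → Vertex n → Vertex n
opposite v a b = zipWith _xor_ v (zipWith _xor_ a b)

bitDist-opposite : ∀ p q r s → bitApart p q r ≡ 0 →
                   bitDist p s + bitDist (p xor (q xor r)) s ≡ bitDist q s + bitDist r s
bitDist-opposite true  true  true  s _ = refl
bitDist-opposite true  true  false s _ = refl
bitDist-opposite true  false true  s _ = ℕP.+-comm (bitDist true s) _
bitDist-opposite true  false false s ()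
bitDist-opposite false true  true  s ()
bitDist-opposite false true  false s _ = ℕP.+-comm (bitDist false s) _
bitDist-opposite false false true  s _ = refl
bitDist-opposite false false false s _ = refl

dist-opposite : (v a b u : Vertex n) → apartFromBoth v a b ≡ 0 →
                dist v u + dist (opposite v a b) u ≡ dist a u + dist b u
dist-opposite []      []      []      []      _  = refl
dist-opposite (p ∷ v) (q ∷ a) (r ∷ b) (s ∷ u) ≡0 = begin
  (bitDist p s + dist v u) + (bitDist p′ s + dist (opposite v a b) u)
    ≡⟨ interchange (bitDist p s) _ _ _ ⟩
  (bitDist p s + bitDist p′ s) + (dist v u + dist (opposite v a b) u)
    ≡⟨ cong₂ _+_ (bitDist-opposite p q r s (ℕP.m+n≡0⇒m≡0 _ ≡0))
                 (dist-opposite v a b u (ℕP.m+n≡0⇒n≡0 (bitApart p q r) ≡0)) ⟩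
  (bitDist q s + bitDist r s) + (dist a u + dist b u)
    ≡⟨ interchange (bitDist q s) _ _ _ ⟩
  (bitDist q s + dist a u) + (bitDist r s + dist b u)
    ∎
  where
  open ≡-Reasoning
  p′ : Bool
  p′ = p xor (q xor r)

m+k*2≡2⇒m≡2∧k≡0 : ∀ m k → m ≢ 0 → m + k * 2 ≡ 2 → m ≡ 2 × k ≡ 0
m+k*2≡2⇒m≡2∧k≡0 zero                k       m≢0 _  = ⊥-elim (m≢0 refl)
m+k*2≡2⇒m≡2∧k≡0 (suc zero)          zero    _   ()
m+k*2≡2⇒m≡2∧k≡0 (suc zero)          (suc k) _   ()
m+k*2≡2⇒m≡2∧k≡0 (suc (suc zero))    zero    _   _  = refl , refl
m+k*2≡2⇒m≡2∧k≡0 (suc (suc zero))    (suc k) _   ()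
m+k*2≡2⇒m≡2∧k≡0 (suc (suc (suc m))) k       _   ()

even∧≤3⇒≤2 : ∀ {m} → m ≤ 3 → m % 2 ≡ 0 → m ≤ 2
even∧≤3⇒≤2 z≤n                   _  = z≤n
even∧≤3⇒≤2 (s≤s z≤n)             ()
even∧≤3⇒≤2 (s≤s (s≤s z≤n))       _  = s≤s (s≤s z≤n)
even∧≤3⇒≤2 (s≤s (s≤s (s≤s z≤n))) ()

odd∧≤3⇒1∨3 : ∀ {m} → m ≤ 3 → m % 2 ≡ 1 → m ≡ 1 ⊎ m ≡ 3
odd∧≤3⇒1∨3 z≤n                   ()
odd∧≤3⇒1∨3 (s≤s z≤n)             _  = inj₁ refl
odd∧≤3⇒1∨3 (s≤s (s≤s z≤n))       ()
odd∧≤3⇒1∨3 (s≤s (s≤s (s≤s z≤n))) _  = inj₂ refl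

≤3⇒≤1∨2∨3 : ∀ {m} → m ≤ 3 → m ≤ 1 ⊎ m ≡ 2 ⊎ m ≡ 3
≤3⇒≤1∨2∨3 z≤n                   = inj₁ z≤n
≤3⇒≤1∨2∨3 (s≤s z≤n)             = inj₁ (s≤s z≤n)
≤3⇒≤1∨2∨3 (s≤s (s≤s z≤n))       = inj₂ (inj₁ refl)
≤3⇒≤1∨2∨3 (s≤s (s≤s (s≤s z≤n))) = inj₂ (inj₂ refl)

module Square {v a b : Vertex n} (v~a : Adj v a) (v~b : Adj v b) (a≢b : a ≢ b) where

  private
    dist-a-b∧apart≡0 : dist a b ≡ 2 × apartFromBoth v a b ≡ 0
    dist-a-b∧apart≡0 = m+k*2≡2⇒m≡2∧k≡0 (dist a b) (apartFromBoth v a b) (a≢b ∘ dist≡0⇒≡)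
      (trans (sym (dist-detour v a b)) (cong₂ _+_ v~a v~b))

  c : Vertex n
  c = opposite v a b

  square : ∀ u → dist v u + dist c u ≡ dist a u + dist b u
  square u = dist-opposite v a b u (proj₂ dist-a-b∧apart≡0)

  c~a : Adj c a
  c~a = ℕP.suc-injective (begin
    1 + dist c a         ≡⟨ cong (_+ dist c a) v~a ⟨
    dist v a + dist c a  ≡⟨ square a ⟩
    dist a a + dist b a  ≡⟨ cong₂ _+_ (dist-self a) (trans (dist-sym b a) (proj₁ dist-a-b∧apart≡0)) ⟩
    2                    ∎)
    where open ≡-Reasoning

  c~b : Adj c b
  c~b = ℕP.suc-injective (begin
    1 + dist c b         ≡⟨ cong (_+ dist c b) v~b ⟨
    dist v b + dist c b  ≡⟨ square b ⟩
    dist a b + dist b b  ≡⟨ cong₂ _+_ (proj₁ dist-a-b∧apart≡0) (dist-self b) ⟩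
    2                    ∎)
    where open ≡-Reasoning

  dist-c-v≡2 : dist c v ≡ 2
  dist-c-v≡2 = begin
    dist c v             ≡⟨ cong (_+ dist c v) (dist-self v) ⟨
    dist v v + dist c v  ≡⟨ square v ⟩
    dist a v + dist b v  ≡⟨ cong₂ _+_ (trans (dist-sym a v) v~a) (trans (dist-sym b v) v~b) ⟩
    2                    ∎
    where open ≡-Reasoning

  -- dist a u and dist b u have the parity of 1 + 3, so they are at most 2
  dist-v≡3⇒dist-c≤1 : ∀ {u} → dist v u ≡ 3 → dist a u ≤ 3 → dist b u ≤ 3 → dist c u ≤ 1
  dist-v≡3⇒dist-c≤1 {u} v-u≡3 a-u≤3 b-u≤3 = ℕP.+-cancelˡ-≤ 3 _ _ (begin
    3 + dist c u         ≡⟨ cong (_+ dist c u) v-u≡3 ⟨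
    dist v u + dist c u  ≡⟨ square u ⟩
    dist a u + dist b u  ≤⟨ ℕP.+-mono-≤ (even∧≤3⇒≤2 a-u≤3 (even v~a)) (even∧≤3⇒≤2 b-u≤3 (even v~b)) ⟩
    4                    ∎)
    where
    open ℕP.≤-Reasoning
    even : ∀ {x} → Adj v x → dist x u % 2 ≡ 0
    even {x} v~x = trans (sym (dist-parity v x u)) (cong₂ (λ d d′ → (d + d′) % 2) v~x v-u≡3)

module _ {A : Set} where

  ∈⇒1≤length : ∀ {x : A} {xs} → x ∈ xs → 1 ≤ length xs
  ∈⇒1≤length (here _)  = s≤s z≤n
  ∈⇒1≤length (there _) = s≤s z≤n

  two-distinct⇒2≤length : ∀ {x y : A} {xs} → x ∈ xs → y ∈ xs → x ≢ y → 2 ≤ length xs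
  two-distinct⇒2≤length (here refl) (here refl) x≢y = ⊥-elim (x≢y refl)
  two-distinct⇒2≤length (here _)    (there y∈)  _   = s≤s (∈⇒1≤length y∈)
  two-distinct⇒2≤length (there x∈)  (here _)    _   = s≤s (∈⇒1≤length x∈)
  two-distinct⇒2≤length (there x∈)  (there y∈)  x≢y = ℕP.m≤n⇒m≤1+n (two-distinct⇒2≤length x∈ y∈ x≢y)

  three-distinct⇒3≤length : ∀ {x y z : A} {xs} → x ∈ xs → y ∈ xs → z ∈ xs →
                            x ≢ y → x ≢ z → y ≢ z → 3 ≤ length xs
  three-distinct⇒3≤length (here refl) (here refl) _           x≢y _   _   = ⊥-elim (x≢y refl)
  three-distinct⇒3≤length (here refl) _           (here refl) _   x≢z _   = ⊥-elim (x≢z refl)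
  three-distinct⇒3≤length _           (here refl) (here refl) _   _   y≢z = ⊥-elim (y≢z refl)
  three-distinct⇒3≤length (here _)    (there y∈)  (there z∈)  _   _   y≢z = s≤s (two-distinct⇒2≤length y∈ z∈ y≢z)
  three-distinct⇒3≤length (there x∈)  (here _)    (there z∈)  _   x≢z _   = s≤s (two-distinct⇒2≤length x∈ z∈ x≢z)
  three-distinct⇒3≤length (there x∈)  (there y∈)  (here _)    x≢y _   _   = s≤s (two-distinct⇒2≤length x∈ y∈ x≢y)
  three-distinct⇒3≤length (there x∈)  (there y∈)  (there z∈)  x≢y x≢z y≢z =
    ℕP.m≤n⇒m≤1+n (three-distinct⇒3≤length x∈ y∈ z∈ x≢y x≢z y≢z)

  unique∧2≤length⇒two-distinct : ∀ {xs : List A} → Unique xs → 2 ≤ length xs →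
                                 ∃[ x ] ∃[ y ] x ∈ xs × y ∈ xs × x ≢ y
  unique∧2≤length⇒two-distinct {x ∷ y ∷ _} ((x≢y ∷ _) ∷ _) _         = x , y , here refl , there (here refl) , x≢y
  unique∧2≤length⇒two-distinct {_ ∷ []}    _                 (s≤s ())

  nonempty⇒∃∈ : {xs : List A} → ¬ xs ≡ [] → ∃[ x ] x ∈ xs
  nonempty⇒∃∈ {[]}    xs≢[] = ⊥-elim (xs≢[] refl)
  nonempty⇒∃∈ {x ∷ _} _     = x , here refl

module _ (w : Vertex n) {σ : List (Vertex n)} where

  private
    adjacent? : ∀ u → Dec (Adj w u)
    adjacent? u = dist w u ℕP.≟ 1

  three-neighbours⇒3≤nbrCount : ∀ {x y z} → x ∈ σ → y ∈ σ → z ∈ σ → Adj w x → Adj w y → Adj w z →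
                                x ≢ y → x ≢ z → y ≢ z → 3 ≤ nbrCount w σ
  three-neighbours⇒3≤nbrCount x∈σ y∈σ z∈σ w~x w~y w~z =
    three-distinct⇒3≤length (∈-filter⁺ adjacent? x∈σ w~x) (∈-filter⁺ adjacent? y∈σ w~y) (∈-filter⁺ adjacent? z∈σ w~z)

  2≤nbrCount⇒two-neighbours : Unique σ → 2 ≤ nbrCount w σ →
                              ∃[ x ] ∃[ y ] x ∈ σ × y ∈ σ × Adj w x × Adj w y × x ≢ y
  2≤nbrCount⇒two-neighbours σ-unique 2≤count
    with unique∧2≤length⇒two-distinct (Unique.filter⁺ adjacent? σ-unique) 2≤count
  ... | x , y , x∈ , y∈ , x≢y with ∈-filter⁻ adjacent? {xs = σ} x∈ | ∈-filter⁻ adjacent? {xs = σ} y∈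
  ...   | x∈σ , w~x | y∈σ , w~y = x , y , x∈σ , y∈σ , w~x , w~y , x≢y

maximal-absorbs : {σ : List (Vertex n)} {x : Vertex n} → IsMaximalSimplex σ →
                  (∀ {u} → u ∈ σ → dist x u ≤ 3) → x ∈ σ
maximal-absorbs {σ = σ} {x} ((σ-unique , _ , σ-close) , maximal) x-close with DecMembership._∈?_ (≡-dec _≟ᵇ_) x σ
... | yes x∈σ = x∈σ
... | no  x∉σ = maximal (x ∷ σ) (unique , (λ ()) , close) there (here refl)
  where
  unique : Unique (x ∷ σ)
  unique = tabulate (λ u∈σ x≡u → x∉σ (subst (_∈ σ) (sym x≡u) u∈σ)) ∷ σ-unique
  close : ∀ {u u′} → u ∈ x ∷ σ → u′ ∈ x ∷ σ → dist u u′ ≤ 3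
  close (here refl) (here refl) = subst (_≤ 3) (sym (dist-self x)) z≤n
  close (here refl) (there u′∈σ) = x-close u′∈σ
  close {u} (there u∈σ) (here refl) = subst (_≤ 3) (dist-sym x u) (x-close u∈σ)
  close (there u∈σ) (there u′∈σ) = σ-close u∈σ u′∈σ

module TwoRegular {σ : List (Vertex n)} (maximal : IsMaximalSimplex σ)
                  (2≤nbrs : ∀ {w} → w ∈ σ → 2 ≤ nbrCount w σ)
                  (nbrs<3 : ∀ {w} → w ∈ σ → nbrCount w σ < 3) where

  private
    close : ∀ {u u′} → u ∈ σ → u′ ∈ σ → dist u u′ ≤ 3
    close = proj₂ (proj₂ (proj₁ maximal))

  σ-neighbours : ∀ {w} → w ∈ σ → ∃[ x ] ∃[ y ] x ∈ σ × y ∈ σ × Adj w x × Adj w y × x ≢ y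
  σ-neighbours {w} w∈σ = 2≤nbrCount⇒two-neighbours w (proj₁ (proj₁ maximal)) (2≤nbrs w∈σ)

  σ-neighbour-is-one-of : ∀ {w x y u} → w ∈ σ → x ∈ σ → y ∈ σ → u ∈ σ →
                          Adj w x → Adj w y → Adj w u → x ≢ y → u ≡ x ⊎ u ≡ y
  σ-neighbour-is-one-of {w} {x} {y} {u} w∈σ x∈σ y∈σ u∈σ w~x w~y w~u x≢y
    with ≡-dec _≟ᵇ_ u x | ≡-dec _≟ᵇ_ u y
  ... | yes u≡x | _       = inj₁ u≡x
  ... | no  _   | yes u≡y = inj₂ u≡y
  ... | no  u≢x | no  u≢y = ⊥-elim (ℕP.<⇒≱ (nbrs<3 w∈σ)
        (three-neighbours⇒3≤nbrCount w x∈σ y∈σ u∈σ w~x w~y w~u x≢y (u≢x ∘ sym) (u≢y ∘ sym)))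

  module Corner {v a b} (v∈σ : v ∈ σ) (a∈σ : a ∈ σ) (b∈σ : b ∈ σ)
                (v~a : Adj v a) (v~b : Adj v b) (a≢b : a ≢ b) where

    open Square {v = v} v~a v~b a≢b

    odd-from-v⇒near-c : ∀ {w} → w ∈ σ → dist v w ≡ 1 ⊎ dist v w ≡ 3 → dist c w ≤ 1
    odd-from-v⇒near-c w∈σ (inj₁ v~w) with σ-neighbour-is-one-of v∈σ a∈σ b∈σ w∈σ v~a v~b v~w a≢b
    ... | inj₁ refl = ℕP.≤-reflexive c~a
    ... | inj₂ refl = ℕP.≤-reflexive c~b
    odd-from-v⇒near-c w∈σ (inj₂ v-w≡3) = dist-v≡3⇒dist-c≤1 v-w≡3 (close a∈σ w∈σ) (close b∈σ w∈σ)

    c∈σ : c ∈ σ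
    c∈σ = maximal-absorbs maximal c-close
      where
      open ℕP.≤-Reasoning
      c-close : ∀ {u} → u ∈ σ → dist c u ≤ 3
      c-close {u} u∈σ with ≤3⇒≤1∨2∨3 (close v∈σ u∈σ)
      ... | inj₁ v-u≤1 = begin
        dist c u             ≤⟨ dist-triangle c v u ⟩
        dist c v + dist v u  ≤⟨ ℕP.+-mono-≤ (ℕP.≤-reflexive dist-c-v≡2) v-u≤1 ⟩
        3                    ∎
      ... | inj₂ (inj₂ v-u≡3) = ℕP.m≤n⇒m≤1+n (ℕP.m≤n⇒m≤1+n (odd-from-v⇒near-c u∈σ (inj₂ v-u≡3)))
      -- a σ-neighbour w of u is at odd distance from v, hence within 1 of c
      ... | inj₂ (inj₁ v-u≡2) with σ-neighbours u∈σ
      ...   | w , _ , w∈σ , _ , u~w , _ = begin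
        dist c u             ≤⟨ dist-triangle c w u ⟩
        dist c w + dist w u  ≤⟨ ℕP.+-mono-≤ (odd-from-v⇒near-c w∈σ v-w-odd) (ℕP.≤-reflexive w~u) ⟩
        2                    <⟨ ℕP.n<1+n 2 ⟩
        3                    ∎
        where
        w~u : Adj w u
        w~u = trans (dist-sym w u) u~w
        v-w-odd : dist v w ≡ 1 ⊎ dist v w ≡ 3
        v-w-odd = odd∧≤3⇒1∨3 (close v∈σ w∈σ) (trans (sym (dist-parity u v w))
          (cong₂ (λ d d′ → (d + d′) % 2) (trans (dist-sym u v) v-u≡2) u~w))

    σ-not-antipodal-to-v : ∀ {u} → u ∈ σ → dist v u ≢ 3
    σ-not-antipodal-to-v {u} u∈σ v-u≡3 with σ-neighbour-is-one-of c∈σ a∈σ b∈σ u∈σ c~a c~b c~u a≢b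
      where
      1≤c-u : 1 ≤ dist c u
      1≤c-u = ℕP.+-cancelˡ-≤ 2 _ _ (begin
        3                    ≡⟨ v-u≡3 ⟨
        dist v u             ≤⟨ dist-triangle v c u ⟩
        dist v c + dist c u  ≡⟨ cong (_+ dist c u) (trans (dist-sym v c) dist-c-v≡2) ⟩
        2 + dist c u         ∎)
        where open ℕP.≤-Reasoning
      c~u : Adj c u
      c~u = ℕP.≤-antisym (odd-from-v⇒near-c u∈σ (inj₂ v-u≡3)) 1≤c-u
    ... | inj₁ refl = contradiction (trans (sym v~a) v-u≡3) λ ()
    ... | inj₂ refl = contradiction (trans (sym v~b) v-u≡3) λ ()

    σ-within-2-of-v : ∀ {u} → u ∈ σ → dist v u ≤ 2
    σ-within-2-of-v u∈σ = ℕP.<⇒≤pred (ℕP.≤∧≢⇒< (close v∈σ u∈σ) (σ-not-antipodal-to-v u∈σ))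

    neighbour-of-v∈σ : ∀ {x} → Adj v x → x ∈ σ
    neighbour-of-v∈σ {x} v~x = maximal-absorbs maximal λ {u} u∈σ → begin
      dist x u             ≤⟨ dist-triangle x v u ⟩
      dist x v + dist v u  ≤⟨ ℕP.+-mono-≤ (ℕP.≤-reflexive (trans (dist-sym x v) v~x)) (σ-within-2-of-v u∈σ) ⟩
      3                    ∎
      where open ℕP.≤-Reasoning

    impossible : 3 ≤ n → ⊥
    impossible 3≤n with three-neighbours 3≤n v
    ... | x , y , z , v~x , v~y , v~z , x≢y , x≢z , y≢z = ℕP.<⇒≱ (nbrs<3 v∈σ)
      (three-neighbours⇒3≤nbrCount v (neighbour-of-v∈σ v~x) (neighbour-of-v∈σ v~y) (neighbour-of-v∈σ v~z)
        v~x v~y v~z x≢y x≢z y≢z)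

  impossible : 3 ≤ n → ⊥
  impossible 3≤n with nonempty⇒∃∈ (proj₁ (proj₂ (proj₁ maximal)))
  ... | v , v∈σ with σ-neighbours v∈σ
  ...   | a , b , a∈σ , b∈σ , v~a , v~b , a≢b = Corner.impossible v∈σ a∈σ b∈σ v~a v~b a≢b 3≤n

lemma4p4 : (n : ℕ) → 5 ≤ n → (σ : List (Vertex n)) → IsMaximalSimplex σ →
    (∀ {w} → w ∈ σ → 2 ≤ nbrCount w σ) →
    Σ (Vertex n) (λ v → v ∈ σ × 3 ≤ nbrCount v σ)
lemma4p4 n 5≤n σ maximal 2≤nbrs with any? (λ w → 3 ℕP.≤? nbrCount w σ) σ
... | yes some = find some
... | no  none = ⊥-elim (TwoRegular.impossible maximal 2≤nbrs (λ w∈σ → ℕP.≰⇒> (none ∘ lose w∈σ))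
                          (ℕP.≤-trans (ℕP.m≤m+n 3 2) 5≤n))
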